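{- Let $(G,S,T,B,C,D)$ be an $(s,t)$-signed-graft and let $T'$ be a one-element set disjoint from $E(G)$. The girth of $M(G,S,T,B,C,D)/T$ is the minimum of the girths of the matroids $M(G,S,T',Bx,C,Dx)/T'$ taken over all vectors $x\in\mathrm{GF}(2)^{T\times T'}$.
   Context: An $(s,t)$-signed-graft is a tuple $(G,S,T,B,C,D)$ where $G$ is a graph, $S$ is an $s$-element set disjoint from $V(G)$, $T$ is a $t$-element set disjoint from $E(G)$, $B\in\mathrm{GF}(2)^{V(G)\times T}$, $C\in\mathrm{GF}(2)^{S\times E(G)}$, $D\in\mathrm{GF}(2)^{S\times T}$. Its incidence matrix has rows $S\cup V(G)$, columns $E(G)\cup T$, and equals $\begin{pmatrix} C & D\\ A(G) & B\end{pmatrix}$ where $A(G)$ is the $\mathrm{GF}(2)$ incidence matrix of $G$; $M(G,S,T,B,C,D)$ is the binary matroid represented by it and $/T$ denotes contraction. A cycle of a binary matroid is a disjoint union of circuits (for $M(A)$: a set of columns summing to zero); the girth is the size of a smallest non-empty cycle ($\infty$ if none). -}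

module Defs where

open import Data.Nat using (ℕ; zero; suc; _+_; _≤_; _<_)
open import Data.Fin using (Fin; zero; suc; _≟_)
open import Data.Bool using (Bool; true; false; _xor_; _∧_; if_then_else_)
open import Data.Sum using (_⊎_; inj₁; inj₂)
open import Data.Product using (_×_; _,_; proj₁; proj₂; Σ; ∃)
open import Relation.Nullary.Decidable using (⌊_⌋)
open import Relation.Binary.PropositionalEquality using (_≡_)

-- GF(2) is modelled by Bool (xor = addition, ∧ = multiplication).

⊕-sum : {k : ℕ} → (Fin k → Bool) → Bool
⊕-sum {zero}  f = false
⊕-sum {suc k} f = f zero xor ⊕-sum (λ i → f (suc i))

∣_∣ : {k : ℕ} → (Fin k → Bool) → ℕ
∣_∣ {zero}  X = 0
∣_∣ {suc k} X = (if X zero then 1 else 0) + ∣ (λ i → X (suc i)) ∣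

-- A graph with vertex set Fin n and edge set Fin m; each edge has two
-- (not necessarily distinct) ends, so loops and parallel edges are allowed.
record Graph (n m : ℕ) : Set where
  field
    ends : Fin m → Fin n × Fin n

-- GF(2) incidence matrix A(G) (rows V(G), columns E(G)); a loop gives a zero column.
incidence : {n m : ℕ} → Graph n m → Fin n → Fin m → Bool
incidence G v e = ⌊ v ≟ proj₁ (Graph.ends G e) ⌋ xor ⌊ v ≟ proj₂ (Graph.ends G e) ⌋

_·_ : {a b c : ℕ} → (Fin a → Fin b → Bool) → (Fin b → Fin c → Bool) → Fin a → Fin c → Bool
(P · Q) i k = ⊕-sum (λ j → P i j ∧ Q j k)

-- Incidence matrix of the (s,t)-signed-graft (G,S,T,B,C,D), with S = Fin s, T = Fin t:
-- rows S ⊎ V(G), columns E(G) ⊎ T, block matrix ( C D ; A(G) B ).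
graftMatrix : {n m s t : ℕ} → Graph n m →
              (B : Fin n → Fin t → Bool) (C : Fin s → Fin m → Bool) (D : Fin s → Fin t → Bool) →
              Fin s ⊎ Fin n → Fin m ⊎ Fin t → Bool
graftMatrix G B C D (inj₁ i) (inj₁ e) = C i e
graftMatrix G B C D (inj₁ i) (inj₂ j) = D i j
graftMatrix G B C D (inj₂ v) (inj₁ e) = incidence G v e
graftMatrix G B C D (inj₂ v) (inj₂ j) = B v j

-- For a binary matrix with columns E ⊎ T, the set X ∪ Y (X ⊆ E, Y ⊆ T) is a
-- cycle of the represented binary matroid M iff its columns sum to zero.
IsCycle : {R : Set} {m t : ℕ} → (R → Fin m ⊎ Fin t → Bool) → (Fin m → Bool) → (Fin t → Bool) → Set
IsCycle {R} M X Y = (i : R) →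
  (⊕-sum (λ e → X e ∧ M i (inj₁ e)) xor ⊕-sum (λ j → Y j ∧ M i (inj₂ j))) ≡ false

-- The cycles of the contraction M/T are exactly the sets C ∖ T for C a cycle of M.
-- M/T has a non-empty cycle of size k (k ≥ 1).
HasCycleOfSize/T : {R : Set} {m t : ℕ} → (R → Fin m ⊎ Fin t → Bool) → ℕ → Set
HasCycleOfSize/T {m = m} {t} M k =
  1 ≤ k × Σ (Fin m → Bool) (λ X → Σ (Fin t → Bool) (λ Y → ∣ X ∣ ≡ k × IsCycle M X Y))

data ℕ∞ : Set where
  fin : ℕ → ℕ∞
  ∞   : ℕ∞

data _≤∞_ : ℕ∞ → ℕ∞ → Set where
  fin≤fin : {a b : ℕ} → a ≤ b → fin a ≤∞ fin b
  _≤∞∞    : (a : ℕ∞) → a ≤∞ ∞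

IsGirth/T : {R : Set} {m t : ℕ} → (R → Fin m ⊎ Fin t → Bool) → ℕ∞ → Set
IsGirth/T M (fin k) = HasCycleOfSize/T M k × ((j : ℕ) → j < k → HasCycleOfSize/T M j → Data.Empty.⊥)
  where import Data.Empty
IsGirth/T M ∞ = (j : ℕ) → HasCycleOfSize/T M j → Data.Empty.⊥
  where import Data.Empty

{-# OPTIONS --safe #-}
module Submission where

-- For x : T → T′, the columns of X ∪ Y′ in the graft (G,S,T′,Bx,C,Dx) sum to the same
-- vector as the columns of X ∪ xY′ in (G,S,T,B,C,D), because (N x) Y′ = N (x Y′) for
-- every row N of the T-block (D ; B).
-- Conversely a cycle X ∪ Y of the latter is X ∪ T′ in the graft with x = Y.  So the
-- sizes of non-empty cycles of M/T form the union over x of those of the M_x/T′, and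
-- the least element of a union is the least of the least elements.

open import Defs
open import Data.Nat using (ℕ; zero; suc; _≤_; _<_)
open import Data.Nat.Properties using (≤-refl; ≤-trans; <⇒≤; <⇒≱; ≮⇒≥)
open import Data.Nat.Induction using (<-wellFounded)
open import Data.Fin using (Fin; zero; suc)
open import Data.Bool using (Bool; true; false; _xor_; _∧_)
open import Data.Bool.Properties using (xor-∧-commutativeRing; xor-identityʳ; ∧-identityʳ)
open import Data.Sum using (_⊎_; inj₁; inj₂)
open import Data.Product using (_×_; ∃; _,_; uncurry)
open import Data.Empty using (⊥-elim)
open import Relation.Nullary using (¬_)
open import Relation.Binary.PropositionalEquality using (_≡_; _≗_; refl; sym; trans; cong; module ≡-Reasoning)
open import Induction.WellFounded using (Acc; acc)
open import Algebra.Bundles using (CommutativeRing)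
open import Algebra.Properties.Semiring.Sum (CommutativeRing.semiring xor-∧-commutativeRing)
  using (sum; sum-cong-≗; ∑-comm; *-distribˡ-sum; *-distribʳ-sum)
open import Function.Bundles using (_⇔_; mk⇔; Equivalence)

⊕-sum≡sum : {k : ℕ} (f : Fin k → Bool) → ⊕-sum f ≡ sum f
⊕-sum≡sum {zero}  f = refl
⊕-sum≡sum {suc k} f = cong (f zero xor_) (⊕-sum≡sum (λ i → f (suc i)))

⊕-sum-cong : {k : ℕ} {f g : Fin k → Bool} → f ≗ g → ⊕-sum f ≡ ⊕-sum g
⊕-sum-cong {f = f} {g} f≗g = begin
  ⊕-sum f ≡⟨ ⊕-sum≡sum f ⟩
  sum f   ≡⟨ sum-cong-≗ f≗g ⟩
  sum g   ≡⟨ ⊕-sum≡sum g ⟨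
  ⊕-sum g ∎
  where open ≡-Reasoning

infixl 7 _·ᵛ_

_·ᵛ_ : {a b : ℕ} → (Fin a → Fin b → Bool) → (Fin b → Bool) → Fin a → Bool
(x ·ᵛ y) j = ⊕-sum (λ j′ → x j j′ ∧ y j′)

∧-rotate : (a b c : Bool) → a ∧ (b ∧ c) ≡ (c ∧ a) ∧ b
∧-rotate false false false = refl
∧-rotate false false true  = refl
∧-rotate false true  false = refl
∧-rotate false true  true  = refl
∧-rotate true  false false = refl
∧-rotate true  false true  = refl
∧-rotate true  true  false = refl
∧-rotate true  true  true  = refl

⊕-sum-·-assoc : {t t′ : ℕ} (N : Fin t → Bool) (x : Fin t → Fin t′ → Bool) (y : Fin t′ → Bool) →
  ⊕-sum (λ j′ → y j′ ∧ ⊕-sum (λ j → N j ∧ x j j′)) ≡ ⊕-sum (λ j → (x ·ᵛ y) j ∧ N j)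
⊕-sum-·-assoc {t} {t′} N x y = begin
  ⊕-sum (λ j′ → y j′ ∧ ⊕-sum (λ j → N j ∧ x j j′))
    ≡⟨ ⊕-sum≡sum (λ j′ → y j′ ∧ ⊕-sum (λ j → N j ∧ x j j′)) ⟩
  sum (λ j′ → y j′ ∧ ⊕-sum (λ j → N j ∧ x j j′))
    ≡⟨ sum-cong-≗ (λ j′ → cong (y j′ ∧_) (⊕-sum≡sum (λ j → N j ∧ x j j′))) ⟩
  sum (λ j′ → y j′ ∧ sum (λ j → N j ∧ x j j′))
    ≡⟨ sum-cong-≗ (λ j′ → *-distribˡ-sum (y j′) (λ j → N j ∧ x j j′)) ⟩
  sum (λ j′ → sum (λ j → y j′ ∧ (N j ∧ x j j′)))
    ≡⟨ ∑-comm {t′} {t} (λ j′ j → y j′ ∧ (N j ∧ x j j′)) ⟩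
  sum (λ j → sum (λ j′ → y j′ ∧ (N j ∧ x j j′)))
    ≡⟨ sum-cong-≗ (λ j → sum-cong-≗ (λ j′ → ∧-rotate (y j′) (N j) (x j j′))) ⟩
  sum (λ j → sum (λ j′ → (x j j′ ∧ y j′) ∧ N j))
    ≡⟨ sum-cong-≗ (λ j → *-distribʳ-sum (N j) (λ j′ → x j j′ ∧ y j′)) ⟨
  sum (λ j → sum (λ j′ → x j j′ ∧ y j′) ∧ N j)
    ≡⟨ sum-cong-≗ (λ j → cong (_∧ N j) (⊕-sum≡sum (λ j′ → x j j′ ∧ y j′))) ⟨
  sum (λ j → (x ·ᵛ y) j ∧ N j)
    ≡⟨ ⊕-sum≡sum (λ j → (x ·ᵛ y) j ∧ N j) ⟨
  ⊕-sum (λ j → (x ·ᵛ y) j ∧ N j)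
    ∎
  where open ≡-Reasoning

column-·ᵛ-true : {t : ℕ} (Y : Fin t → Bool) → (λ j (_ : Fin 1) → Y j) ·ᵛ (λ _ → true) ≗ Y
column-·ᵛ-true Y j = trans (xor-identityʳ (Y j ∧ true)) (∧-identityʳ (Y j))

cycleSum : {R : Set} {m t : ℕ} → (R → Fin m ⊎ Fin t → Bool) → (Fin m → Bool) → (Fin t → Bool) → R → Bool
cycleSum M X Y r = ⊕-sum (λ e → X e ∧ M r (inj₁ e)) xor ⊕-sum (λ j → Y j ∧ M r (inj₂ j))

IsCycle-congʳ : {R : Set} {m t : ℕ} (M : R → Fin m ⊎ Fin t → Bool) {X : Fin m → Bool} {Y Y′ : Fin t → Bool} →
  Y ≗ Y′ → IsCycle M X Y → IsCycle M X Y′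
IsCycle-congʳ M {X} Y≗Y′ cycle r =
  trans (cong (⊕-sum (λ e → X e ∧ M r (inj₁ e)) xor_) (⊕-sum-cong (λ j → cong (_∧ M r (inj₂ j)) (sym (Y≗Y′ j)))))
        (cycle r)

module _ {n m s t : ℕ} (G : Graph n m)
    (B : Fin n → Fin t → Bool) (C : Fin s → Fin m → Bool) (D : Fin s → Fin t → Bool) where

  cycleSum-· : {t′ : ℕ} (x : Fin t → Fin t′ → Bool) (X : Fin m → Bool) (Y : Fin t′ → Bool) →
    cycleSum (graftMatrix G (B · x) C (D · x)) X Y ≗ cycleSum (graftMatrix G B C D) X (x ·ᵛ Y)
  cycleSum-· x X Y (inj₁ i) = cong (⊕-sum (λ e → X e ∧ C i e) xor_) (⊕-sum-·-assoc (D i) x Y)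
  cycleSum-· x X Y (inj₂ v) = cong (⊕-sum (λ e → X e ∧ incidence G v e) xor_) (⊕-sum-·-assoc (B v) x Y)

  IsCycle-·⇔ : {t′ : ℕ} (x : Fin t → Fin t′ → Bool) (X : Fin m → Bool) (Y : Fin t′ → Bool) →
    IsCycle (graftMatrix G (B · x) C (D · x)) X Y ⇔ IsCycle (graftMatrix G B C D) X (x ·ᵛ Y)
  IsCycle-·⇔ x X Y = mk⇔ (λ cycle r → trans (sym (cycleSum-· x X Y r)) (cycle r))
                         (λ cycle r → trans (cycleSum-· x X Y r) (cycle r))

  hasCycleOfSize⇔one-column : (k : ℕ) →
    HasCycleOfSize/T (graftMatrix G B C D) k ⇔
      ∃ λ (x : Fin t → Fin 1 → Bool) → HasCycleOfSize/T (graftMatrix G (B · x) C (D · x)) k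
  hasCycleOfSize⇔one-column k = mk⇔ to from
    where
    to : HasCycleOfSize/T (graftMatrix G B C D) k →
         ∃ λ (x : Fin t → Fin 1 → Bool) → HasCycleOfSize/T (graftMatrix G (B · x) C (D · x)) k
    to (1≤k , X , Y , ∣X∣≡k , cycle) =
      x , 1≤k , X , (λ _ → true) , ∣X∣≡k ,
      Equivalence.from (IsCycle-·⇔ x X (λ _ → true))
        (IsCycle-congʳ (graftMatrix G B C D) (λ j → sym (column-·ᵛ-true Y j)) cycle)
      where
      x : Fin t → Fin 1 → Bool
      x j _ = Y j
    from : (∃ λ (x : Fin t → Fin 1 → Bool) → HasCycleOfSize/T (graftMatrix G (B · x) C (D · x)) k) →
           HasCycleOfSize/T (graftMatrix G B C D) k
    from (x , 1≤k , X , Y , ∣X∣≡k , cycle) =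
      1≤k , X , x ·ᵛ Y , ∣X∣≡k , Equivalence.to (IsCycle-·⇔ x X Y) cycle

-- P need not be decidable, so a least witness exists only up to double negation.
¬¬-least : (P : ℕ → Set) {j : ℕ} → P j → ¬ ¬ (∃ λ k → k ≤ j × P k × ((i : ℕ) → i < k → ¬ P i))
¬¬-least P = go (<-wellFounded _)
  where
  go : {j : ℕ} → Acc _<_ j → P j → ¬ ¬ (∃ λ k → k ≤ j × P k × ((i : ℕ) → i < k → ¬ P i))
  go {j} (acc below) pj noLeast =
    noLeast (j , ≤-refl , pj , λ i i<j pi →
      go (below i<j) pi (λ (k , k≤i , least) → noLeast (k , ≤-trans k≤i (<⇒≤ i<j) , least)))

fin≤fin⁻¹ : {a b : ℕ} → fin a ≤∞ fin b → a ≤ b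
fin≤fin⁻¹ (fin≤fin a≤b) = a≤b

∞≰fin : {b : ℕ} → ¬ (∞ ≤∞ fin b)
∞≰fin ()

module _ {I R R′ : Set} {m t t′ : ℕ} (M : R → Fin m ⊎ Fin t → Bool) (N : I → R′ → Fin m ⊎ Fin t′ → Bool)
    (i₀ : I) (sizes : (k : ℕ) → HasCycleOfSize/T M k ⇔ ∃ λ i → HasCycleOfSize/T (N i) k) where

  private
    cycle-of : {i : I} {k : ℕ} → HasCycleOfSize/T (N i) k → HasCycleOfSize/T M k
    cycle-of {i} {k} cycle = Equivalence.from (sizes k) (i , cycle)

  girth-attained : {g : ℕ∞} → IsGirth/T M g → ∃ λ i → IsGirth/T (N i) g
  girth-attained {fin k} (cycle , minimal) with Equivalence.to (sizes k) cycle
  ... | i , cycleᵢ = i , cycleᵢ , λ j j<k cycleⱼ → minimal j j<k (cycle-of cycleⱼ)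
  girth-attained {∞} acyclic = i₀ , λ j cycle → acyclic j (cycle-of cycle)

  girth-lower-bound : {g : ℕ∞} → IsGirth/T M g → (i : I) (h : ℕ∞) → IsGirth/T (N i) h → g ≤∞ h
  girth-lower-bound {g}     _             i ∞       _           = g ≤∞∞
  girth-lower-bound {fin k} (_ , minimal) i (fin h) (cycle , _) =
    fin≤fin (≮⇒≥ (λ h<k → minimal h h<k (cycle-of cycle)))
  girth-lower-bound {∞}     acyclic       i (fin h) (cycle , _) = ⊥-elim (acyclic h (cycle-of cycle))

  girth-from-bounds : {g : ℕ∞} → (∃ λ i → IsGirth/T (N i) g) → ((i : I) (h : ℕ∞) → IsGirth/T (N i) h → g ≤∞ h) →
    IsGirth/T M g
  girth-from-bounds {fin k} (i , cycle , _) bound = cycle-of cycle , no-smaller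
    where
    no-smaller : (j : ℕ) → j < k → ¬ HasCycleOfSize/T M j
    no-smaller j j<k cycleⱼ with Equivalence.to (sizes j) cycleⱼ
    ... | i′ , cycle′ = ¬¬-least _ cycle′ λ (j′ , j′≤j , girth′) →
      <⇒≱ j<k (≤-trans (fin≤fin⁻¹ (bound i′ (fin j′) girth′)) j′≤j)
  girth-from-bounds {∞} _ bound j cycleⱼ with Equivalence.to (sizes j) cycleⱼ
  ... | i′ , cycle′ = ¬¬-least _ cycle′ λ (j′ , _ , girth′) → ∞≰fin (bound i′ (fin j′) girth′)

  girth-of-union : (g : ℕ∞) →
    IsGirth/T M g ⇔ ((∃ λ i → IsGirth/T (N i) g) × ((i : I) (h : ℕ∞) → IsGirth/T (N i) h → g ≤∞ h))
  girth-of-union _ = mk⇔ (λ girth → girth-attained girth , girth-lower-bound girth) (uncurry girth-from-bounds)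

lemma4p3 : {n m s t : ℕ} (G : Graph n m)
    (B : Fin n → Fin t → Bool) (C : Fin s → Fin m → Bool) (D : Fin s → Fin t → Bool)
    (g : ℕ∞) →
    IsGirth/T (graftMatrix G B C D) g ⇔
      ((∃ λ (x : Fin t → Fin 1 → Bool) → IsGirth/T (graftMatrix G (B · x) C (D · x)) g)
       × ((x : Fin t → Fin 1 → Bool) (h : ℕ∞) →
            IsGirth/T (graftMatrix G (B · x) C (D · x)) h → g ≤∞ h))
lemma4p3 G B C D =
  girth-of-union (graftMatrix G B C D) (λ x → graftMatrix G (B · x) C (D · x))
    (λ _ _ → false) (hasCycleOfSize⇔one-column G B C D)
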